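{- Let $n$ be a positive integer and let $A$ be an $n\times n$ matrix with integer entries, with rows and columns indexed by $\{0,1,\ldots,n-1\}$. For an integer $x$, let $M=M(x)=\operatorname{adj}(xI-A)$, let $v=(1,2,\ldots,n)^T$, let $y=Mv\in\mathbb{Z}^n$ and let $m=m(x)=\det(xI-A)$. Then there exists $x_0$ such that for every integer $x>x_0$, $$0<y_0<y_1<\cdots<y_{n-1}<m.$$
   Context: $\operatorname{adj}$ denotes the adjugate matrix and $I$ the $n\times n$ identity matrix; $y$ and $m$ depend on the integer $x$. -}

module Defs where

open import Data.Nat using (ℕ; zero; suc)
open import Data.Fin using (Fin; zero; suc; toℕ; punchIn)
open import Data.Integer using (ℤ; +_; _+_; _*_; -_; _-_)

Matrix : ℕ → Set
Matrix n = Fin n → Fin n → ℤ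

sumFin : (n : ℕ) → (Fin n → ℤ) → ℤ
sumFin zero    f = + 0
sumFin (suc n) f = f zero + sumFin n (λ j → f (suc j))

sgn : ℕ → ℤ
sgn zero    = + 1
sgn (suc k) = - sgn k

δ : {n : ℕ} → Fin n → Fin n → ℤ
δ zero    zero    = + 1
δ zero    (suc j) = + 0
δ (suc i) zero    = + 0
δ (suc i) (suc j) = δ i j

minor : {n : ℕ} → Matrix (suc n) → Fin (suc n) → Fin (suc n) → Matrix n
minor B i j r c = B (punchIn i r) (punchIn j c)

det : (n : ℕ) → Matrix n → ℤ
det zero    B = + 1
det (suc n) B = sumFin (suc n) (λ j → sgn (toℕ j) * (B zero j * det n (minor B zero j)))

adj : (n : ℕ) → Matrix n → Matrix n
adj zero    B ()
adj (suc n) B i j = sgn (toℕ i Data.Nat.+ toℕ j) * det n (minor B j i)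

charMat : (n : ℕ) → ℤ → Matrix n → Matrix n
charMat n x A i j = x * δ i j - A i j

{-# OPTIONS --safe #-}
module Submission where

-- Entrywise, xI − A is x·δ + O(1). Expanding along the first row gives det(xI − A) = xⁿ + O(xⁿ⁻¹);
-- a minor of xI − A deleting row i and column j ≠ i still contains row j without its diagonal
-- entry, a row constant in x, so its determinant is O(xⁿ⁻²). Hence adj(xI − A) = xⁿ⁻¹ I + O(xⁿ⁻²),
-- so yᵢ = (i + 1) xⁿ⁻¹ + O(xⁿ⁻²) and m = xⁿ + O(xⁿ⁻¹). Thus y₀, yᵢ₊₁ − yᵢ and m − yₙ₋₁ all have
-- leading coefficient 1 and are positive for large x.

open import Defs
open import Data.Nat as ℕ using (ℕ; zero; suc; z≤n; s≤s)
import Data.Nat.Properties as ℕₚ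
open import Data.Fin using (Fin; zero; suc; toℕ; inject₁; fromℕ; punchIn; punchOut)
import Data.Fin.Properties as Finₚ
open import Data.Integer using (ℤ; +_; -[1+_]; _+_; _-_; -_; _*_; _<_; ∣_∣; +<+)
import Data.Integer.Properties as ℤₚ
open import Data.Integer.Tactic.RingSolver using (solve-∀)
open import Data.Product using (∃; _×_; _,_; proj₁; proj₂)
open import Function using (_∘_)
open import Relation.Nullary using (yes; no; contradiction)
open import Relation.Binary.PropositionalEquality

-- F X = O(Xᵈ). The bound is imposed at positive X only, since 0ᵈ = 0.
record BigO (F : ℕ → ℤ) (d : ℕ) : Set where
  constructor bigO
  field
    C     : ℕ
    bound : ∀ X → ∣ F (suc X) ∣ ℕ.≤ C ℕ.* suc X ℕ.^ d

O-cong : ∀ {F G d} → (∀ X → F X ≡ G X) → BigO F d → BigO G d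
O-cong {d = d} F≗G (bigO C h) = bigO C λ X → subst (λ z → ∣ z ∣ ℕ.≤ C ℕ.* suc X ℕ.^ d) (F≗G (suc X)) (h X)

O-const : ∀ c → BigO (λ _ → c) 0
O-const c = bigO ∣ c ∣ λ X → ℕₚ.≤-reflexive (sym (ℕₚ.*-identityʳ ∣ c ∣))

O-pow : ∀ d → BigO (λ X → + (X ℕ.^ d)) d
O-pow d = bigO 1 λ X → ℕₚ.≤-reflexive (sym (ℕₚ.*-identityˡ _))

O-id : BigO +_ 1
O-id = bigO 1 λ X → ℕₚ.≤-reflexive (sym (trans (ℕₚ.*-identityˡ _) (ℕₚ.*-identityʳ (suc X))))

O-mono : ∀ {F d e} → d ℕ.≤ e → BigO F d → BigO F e
O-mono d≤e (bigO C h) = bigO C λ X → ℕₚ.≤-trans (h X) (ℕₚ.*-monoʳ-≤ C (ℕₚ.^-monoʳ-≤ (suc X) d≤e))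

O-+ : ∀ {F G d} → BigO F d → BigO G d → BigO (λ X → F X + G X) d
O-+ {F} {G} {d} (bigO C h) (bigO D k) = bigO (C ℕ.+ D) λ X → begin
  ∣ F (suc X) + G (suc X) ∣               ≤⟨ ℤₚ.∣i+j∣≤∣i∣+∣j∣ (F (suc X)) (G (suc X)) ⟩
  ∣ F (suc X) ∣ ℕ.+ ∣ G (suc X) ∣         ≤⟨ ℕₚ.+-mono-≤ (h X) (k X) ⟩
  C ℕ.* suc X ℕ.^ d ℕ.+ D ℕ.* suc X ℕ.^ d ≡⟨ ℕₚ.*-distribʳ-+ (suc X ℕ.^ d) C D ⟨
  (C ℕ.+ D) ℕ.* suc X ℕ.^ d               ∎
  where open ℕₚ.≤-Reasoning

O-neg : ∀ {F d} → BigO F d → BigO (λ X → - F X) d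
O-neg {F} (bigO C h) = bigO C λ X → subst (ℕ._≤ _) (sym (ℤₚ.∣-i∣≡∣i∣ (F (suc X)))) (h X)

O-- : ∀ {F G d} → BigO F d → BigO G d → BigO (λ X → F X - G X) d
O-- hF hG = O-+ hF (O-neg hG)

O-* : ∀ {F G d e} → BigO F d → BigO G e → BigO (λ X → F X * G X) (d ℕ.+ e)
O-* {F} {G} {d} {e} (bigO C h) (bigO D k) = bigO (C ℕ.* D) λ X → begin
  ∣ F (suc X) * G (suc X) ∣                         ≡⟨ ℤₚ.∣i*j∣≡∣i∣*∣j∣ (F (suc X)) (G (suc X)) ⟩
  ∣ F (suc X) ∣ ℕ.* ∣ G (suc X) ∣                   ≤⟨ ℕₚ.*-mono-≤ (h X) (k X) ⟩
  (C ℕ.* suc X ℕ.^ d) ℕ.* (D ℕ.* suc X ℕ.^ e)       ≡⟨ ℕₚ.[m*n]*[o*p]≡[m*o]*[n*p] C _ D _ ⟩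
  (C ℕ.* D) ℕ.* (suc X ℕ.^ d ℕ.* suc X ℕ.^ e)       ≡⟨ cong (C ℕ.* D ℕ.*_) (ℕₚ.^-distribˡ-+-* (suc X) d e) ⟨
  C ℕ.* D ℕ.* suc X ℕ.^ (d ℕ.+ e)                   ∎
  where open ℕₚ.≤-Reasoning

∣sgn*i∣≡∣i∣ : ∀ k i → ∣ sgn k * i ∣ ≡ ∣ i ∣
∣sgn*i∣≡∣i∣ zero    i = cong ∣_∣ (ℤₚ.*-identityˡ i)
∣sgn*i∣≡∣i∣ (suc k) i = begin
  ∣ - sgn k * i ∣   ≡⟨ cong ∣_∣ (ℤₚ.neg-distribˡ-* (sgn k) i) ⟨
  ∣ - (sgn k * i) ∣ ≡⟨ ℤₚ.∣-i∣≡∣i∣ (sgn k * i) ⟩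
  ∣ sgn k * i ∣     ≡⟨ ∣sgn*i∣≡∣i∣ k i ⟩
  ∣ i ∣             ∎
  where open ≡-Reasoning

sgn[m+m]≡1 : ∀ m → sgn (m ℕ.+ m) ≡ + 1
sgn[m+m]≡1 zero    = refl
sgn[m+m]≡1 (suc m) = begin
  - sgn (m ℕ.+ suc m)   ≡⟨ cong (-_ ∘ sgn) (ℕₚ.+-suc m m) ⟩
  - - sgn (m ℕ.+ m)     ≡⟨ ℤₚ.neg-involutive (sgn (m ℕ.+ m)) ⟩
  sgn (m ℕ.+ m)         ≡⟨ sgn[m+m]≡1 m ⟩
  + 1                   ∎
  where open ≡-Reasoning

O-sgn : ∀ {F d} k → BigO F d → BigO (λ X → sgn k * F X) d
O-sgn {F} k (bigO C h) = bigO C λ X → subst (ℕ._≤ _) (sym (∣sgn*i∣≡∣i∣ k (F (suc X)))) (h X)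

O-sumFin : ∀ {d} n {F : Fin n → ℕ → ℤ} → (∀ j → BigO (F j) d) → BigO (λ X → sumFin n (λ j → F j X)) d
O-sumFin zero    _ = bigO 0 λ _ → z≤n
O-sumFin (suc n) h = O-+ (h zero) (O-sumFin n (h ∘ suc))

sumFin-cong : ∀ n {f g : Fin n → ℤ} → (∀ j → f j ≡ g j) → sumFin n f ≡ sumFin n g
sumFin-cong zero    _   = refl
sumFin-cong (suc n) f≗g = cong₂ _+_ (f≗g zero) (sumFin-cong n (f≗g ∘ suc))

sumFin-zero : ∀ n {f : Fin n → ℤ} → (∀ j → f j ≡ + 0) → sumFin n f ≡ + 0
sumFin-zero zero    _  = refl
sumFin-zero (suc n) f≗0 = cong₂ _+_ (f≗0 zero) (sumFin-zero n (f≗0 ∘ suc))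

sumFin-minus : ∀ n (f g : Fin n → ℤ) → sumFin n (λ j → f j - g j) ≡ sumFin n f - sumFin n g
sumFin-minus zero    f g = refl
sumFin-minus (suc n) f g = begin
  (f zero - g zero) + sumFin n (λ j → f (suc j) - g (suc j))
    ≡⟨ cong (_+_ (f zero - g zero)) (sumFin-minus n (f ∘ suc) (g ∘ suc)) ⟩
  (f zero - g zero) + (sumFin n (f ∘ suc) - sumFin n (g ∘ suc))
    ≡⟨ regroup (f zero) (g zero) _ _ ⟩
  (f zero + sumFin n (f ∘ suc)) - (g zero + sumFin n (g ∘ suc))
    ∎
  where
  open ≡-Reasoning
  regroup : ∀ a b s t → (a - b) + (s - t) ≡ (a + s) - (b + t)
  regroup = solve-∀

sumFin-δ : ∀ n (i : Fin n) (g : Fin n → ℤ) → sumFin n (λ j → δ i j * g j) ≡ g i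
sumFin-δ (suc n) zero    g = begin
  + 1 * g zero + sumFin n (λ j → + 0 * g (suc j)) ≡⟨ cong (_+_ (+ 1 * g zero)) (sumFin-zero n (λ _ → refl)) ⟩
  + 1 * g zero + + 0                              ≡⟨ ℤₚ.+-identityʳ _ ⟩
  + 1 * g zero                                    ≡⟨ ℤₚ.*-identityˡ (g zero) ⟩
  g zero                                          ∎
  where open ≡-Reasoning
sumFin-δ (suc n) (suc i) g = trans (cong (_+_ (+ 0 * g zero)) (sumFin-δ n i (g ∘ suc))) (ℤₚ.+-identityˡ (g (suc i)))

det-cong : ∀ n {B B′ : Matrix n} → (∀ r c → B r c ≡ B′ r c) → det n B ≡ det n B′
det-cong zero    _     = refl
det-cong (suc n) B≗B′ = sumFin-cong (suc n) λ j →
  cong₂ (λ b d → sgn (toℕ j) * (b * d)) (B≗B′ zero j) (det-cong n λ r c → B≗B′ (suc r) (punchIn j c))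

det-O-linear : ∀ n (B : ℕ → Matrix n) → (∀ r c → BigO (λ X → B X r c) 1) → BigO (λ X → det n (B X)) n
det-O-linear zero    B lin = O-const (+ 1)
det-O-linear (suc n) B lin = O-sumFin (suc n) λ j → O-sgn (toℕ j)
  (O-* (lin zero j) (det-O-linear n (λ X → minor (B X) zero j) λ r c → lin (suc r) (punchIn j c)))

det-O-constRow : ∀ n (B : ℕ → Matrix (suc n)) (r₀ : Fin (suc n)) →
                 (∀ r c → BigO (λ X → B X r c) 1) → (∀ c → BigO (λ X → B X r₀ c) 0) →
                 BigO (λ X → det (suc n) (B X)) n
det-O-constRow n       B zero     lin const = O-sumFin (suc n) λ j → O-sgn (toℕ j)
  (O-* (const j) (det-O-linear n (λ X → minor (B X) zero j) λ r c → lin (suc r) (punchIn j c)))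
det-O-constRow (suc n) B (suc r₀) lin const = O-sumFin (suc (suc n)) λ j → O-sgn (toℕ j)
  (O-* (lin zero j) (det-O-constRow n (λ X → minor (B X) zero j) r₀
    (λ r c → lin (suc r) (punchIn j c)) (const ∘ punchIn j)))

δ-refl : ∀ {n} (i : Fin n) → δ i i ≡ + 1
δ-refl zero    = refl
δ-refl (suc i) = δ-refl i

δ-≢ : ∀ {n} {i j : Fin n} → i ≢ j → δ i j ≡ + 0
δ-≢ {i = zero}  {zero}  i≢j = contradiction refl i≢j
δ-≢ {i = zero}  {suc j} _   = refl
δ-≢ {i = suc i} {zero}  _   = refl
δ-≢ {i = suc i} {suc j} i≢j = δ-≢ (i≢j ∘ cong suc)

δ-punchIn : ∀ {n} (i : Fin (suc n)) (r c : Fin n) → δ (punchIn i r) (punchIn i c) ≡ δ r c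
δ-punchIn zero    r       c       = refl
δ-punchIn (suc i) zero    zero    = refl
δ-punchIn (suc i) zero    (suc c) = refl
δ-punchIn (suc i) (suc r) zero    = refl
δ-punchIn (suc i) (suc r) (suc c) = δ-punchIn i r c

minor-charMat-diag : ∀ n x (A : Matrix (suc n)) i r c →
                     minor (charMat (suc n) x A) i i r c ≡ charMat n x (minor A i i) r c
minor-charMat-diag n x A i r c = cong (λ d → x * d - minor A i i r c) (δ-punchIn i r c)

charPoly : (n : ℕ) → Matrix n → ℕ → ℤ
charPoly n A X = det n (charMat n (+ X) A)

adjCharMat : (n : ℕ) → Matrix n → ℕ → Matrix n
adjCharMat n A X = adj n (charMat n (+ X) A)

adjCharMat·v : (n : ℕ) → Matrix n → ℕ → Fin n → ℤ
adjCharMat·v n A X i = sumFin n λ j → adjCharMat n A X i j * + suc (toℕ j)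

charMat-O : ∀ n (A : Matrix n) r c → BigO (λ X → charMat n (+ X) A r c) 1
charMat-O n A r c = O-- (O-* O-id (O-const (δ r c))) (O-mono z≤n (O-const (A r c)))

charMat-offDiag-O : ∀ n (A : Matrix n) {r c} → r ≢ c → BigO (λ X → charMat n (+ X) A r c) 0
charMat-offDiag-O n A {r} {c} r≢c = O-cong (λ X → sym (offDiag X)) (O-const (- A r c))
  where
  offDiag : ∀ X → + X * δ r c - A r c ≡ - A r c
  offDiag X = begin
    + X * δ r c - A r c ≡⟨ cong (λ d → + X * d - A r c) (δ-≢ r≢c) ⟩
    + X * + 0 - A r c   ≡⟨ cong (_- A r c) (ℤₚ.*-zeroʳ (+ X)) ⟩
    + 0 - A r c         ≡⟨ ℤₚ.+-identityˡ (- A r c) ⟩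
    - A r c             ∎
    where open ≡-Reasoning

-- Row j of xI − A survives in the minor with its diagonal entry deleted.
det-minor-charMat-O : ∀ n (A : Matrix (suc (suc n))) {i j} → i ≢ j →
                      BigO (λ X → det (suc n) (minor (charMat (suc (suc n)) (+ X) A) i j)) n
det-minor-charMat-O n A {i} {j} i≢j = det-O-constRow n _ (punchOut i≢j)
  (λ r c → charMat-O _ A (punchIn i r) (punchIn j c))
  (λ c → charMat-offDiag-O _ A λ e → Finₚ.punchInᵢ≢i j c (trans (sym e) (Finₚ.punchIn-punchOut i≢j)))

det-charMat-leading : ∀ n (A : Matrix (suc n)) → BigO (λ X → charPoly (suc n) A X - + (X ℕ.^ suc n)) n
det-charMat-leading zero    A = O-cong expand (O-const (- a))
  where
  a = A zero zero
  expand : ∀ X → - a ≡ charPoly 1 A X - + (X ℕ.^ 1)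
  expand X = begin
    - a                          ≡⟨ linear (+ X) a ⟩
    charPoly 1 A X - + X * + 1   ≡⟨ cong (_-_ (charPoly 1 A X)) (ℤₚ.pos-* X 1) ⟨
    charPoly 1 A X - + (X ℕ.^ 1) ∎
    where
    open ≡-Reasoning
    linear : ∀ x a → - a ≡ + 1 * ((x * + 1 - a) * + 1) + + 0 - x * + 1
    linear = solve-∀
det-charMat-leading (suc n) A = O-cong expand
  (O-+ (O-+ (O-+ (O-* O-id IH) (O-mono (ℕₚ.n≤1+n n) (O-* (O-const (- a)) IH)))
            (O-* (O-const (- a)) (O-pow (suc n))))
       (O-mono (ℕₚ.n≤1+n n) (O-sumFin (suc n) λ j → O-sgn (toℕ (suc j))
         (O-* (charMat-offDiag-O _ A {zero} {suc j} λ ()) (det-minor-charMat-O n A {zero} {suc j} λ ())))))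
  where
  B : ℕ → Matrix (suc (suc n))
  B X = charMat (suc (suc n)) (+ X) A
  a = A zero zero
  D P S : ℕ → ℤ
  D = charPoly (suc n) (minor A zero zero)
  P X = + (X ℕ.^ suc n)
  S X = sumFin (suc n) λ j → sgn (toℕ (suc j)) * (B X zero (suc j) * det (suc n) (minor (B X) zero (suc j)))
  IH : BigO (λ X → D X - P X) n
  IH = det-charMat-leading n (minor A zero zero)
  expand : ∀ X → + X * (D X - P X) + (- a) * (D X - P X) + (- a) * P X + S X
               ≡ charPoly (suc (suc n)) A X - + (X ℕ.^ suc (suc n))
  expand X = begin
    + X * (D X - P X) + (- a) * (D X - P X) + (- a) * P X + S X ≡⟨ firstRow (+ X) a (D X) (P X) (S X) ⟩
    charPoly (suc (suc n)) A X - + X * P X                      ≡⟨ cong (_-_ (charPoly (suc (suc n)) A X))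
                                                                         (ℤₚ.pos-* X (X ℕ.^ suc n)) ⟨
    charPoly (suc (suc n)) A X - + (X ℕ.^ suc (suc n))          ∎
    where
    open ≡-Reasoning
    firstRow : ∀ x a D P S → x * (D - P) + (- a) * (D - P) + (- a) * P + S ≡ + 1 * ((x * + 1 - a) * D) + S - x * P
    firstRow = solve-∀

adjCharMat-leading : ∀ n (A : Matrix (suc (suc n))) i j →
                     BigO (λ X → adjCharMat (suc (suc n)) A X i j - δ i j * + (X ℕ.^ suc n)) n
adjCharMat-leading n A i j with i Finₚ.≟ j
... | yes refl = O-cong diagonal (det-charMat-leading n (minor A i i))
  where
  diagonal : ∀ X → charPoly (suc n) (minor A i i) X - + (X ℕ.^ suc n)
                   ≡ adjCharMat (suc (suc n)) A X i i - δ i i * + (X ℕ.^ suc n)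
  diagonal X = begin
    charPoly (suc n) (minor A i i) X - P
      ≡⟨ cong (_- P) (det-cong (suc n) (minor-charMat-diag (suc n) (+ X) A i)) ⟨
    det (suc n) M - P
      ≡⟨ cong₂ _-_ (ℤₚ.*-identityˡ (det (suc n) M)) (ℤₚ.*-identityˡ P) ⟨
    + 1 * det (suc n) M - + 1 * P
      ≡⟨ cong₂ (λ s t → s * det (suc n) M - t * P) (sgn[m+m]≡1 (toℕ i)) (δ-refl i) ⟨
    sgn (toℕ i ℕ.+ toℕ i) * det (suc n) M - δ i i * P
      ∎
    where
    open ≡-Reasoning
    P = + (X ℕ.^ suc n)
    M = minor (charMat (suc (suc n)) (+ X) A) i i
... | no i≢j = O-cong offDiagonal (O-sgn (toℕ i ℕ.+ toℕ j) (det-minor-charMat-O n A (i≢j ∘ sym)))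
  where
  offDiagonal : ∀ X → adjCharMat (suc (suc n)) A X i j ≡ adjCharMat (suc (suc n)) A X i j - δ i j * + (X ℕ.^ suc n)
  offDiagonal X = sym (trans (cong (λ d → M - d * + (X ℕ.^ suc n)) (δ-≢ i≢j)) (ℤₚ.+-identityʳ M))
    where M = adjCharMat (suc (suc n)) A X i j

adjCharMat·v-leading : ∀ n (A : Matrix (suc (suc n))) i →
                       BigO (λ X → adjCharMat·v (suc (suc n)) A X i - + suc (toℕ i) * + (X ℕ.^ suc n)) n
adjCharMat·v-leading n A i =
  O-cong collect (O-sumFin (suc (suc n)) λ j → O-* (O-const (v j)) (adjCharMat-leading n A i j))
  where
  v : Fin (suc (suc n)) → ℤ
  v j = + suc (toℕ j)
  collect : ∀ X → sumFin (suc (suc n)) (λ j → v j * (adjCharMat (suc (suc n)) A X i j - δ i j * + (X ℕ.^ suc n)))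
                  ≡ adjCharMat·v (suc (suc n)) A X i - v i * + (X ℕ.^ suc n)
  collect X = begin
    sumFin (suc (suc n)) (λ j → v j * (M i j - δ i j * P))
      ≡⟨ sumFin-cong (suc (suc n)) (λ j → distrib (v j) (M i j) (δ i j) P) ⟩
    sumFin (suc (suc n)) (λ j → M i j * v j - δ i j * (v j * P))
      ≡⟨ sumFin-minus (suc (suc n)) (λ j → M i j * v j) (λ j → δ i j * (v j * P)) ⟩
    y - sumFin (suc (suc n)) (λ j → δ i j * (v j * P))
      ≡⟨ cong (_-_ y) (sumFin-δ (suc (suc n)) i (λ j → v j * P)) ⟩
    y - v i * P
      ∎
    where
    open ≡-Reasoning
    M = adjCharMat (suc (suc n)) A X
    P = + (X ℕ.^ suc n)
    y = adjCharMat·v (suc (suc n)) A X i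
    distrib : ∀ c m d p → c * (m - d * p) ≡ m * c - d * (c * p)
    distrib = solve-∀

-- For n = 1 the adjugate is (1), so y₀ = 1 by computation.
adjCharMat·v-O : ∀ n (A : Matrix (suc n)) i → BigO (λ X → adjCharMat·v (suc n) A X i) n
adjCharMat·v-O zero    A zero = O-const (+ 1)
adjCharMat·v-O (suc n) A i    = O-cong restore
  (O-+ (O-mono (ℕₚ.n≤1+n n) (adjCharMat·v-leading n A i)) (O-* (O-const (+ suc (toℕ i))) (O-pow (suc n))))
  where
  restore : ∀ X → adjCharMat·v (suc (suc n)) A X i - + suc (toℕ i) * + (X ℕ.^ suc n) + + suc (toℕ i) * + (X ℕ.^ suc n)
                  ≡ adjCharMat·v (suc (suc n)) A X i
  restore X = minus-plus _ _
    where
    minus-plus : ∀ a b → a - b + b ≡ a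
    minus-plus = solve-∀

Eventually : (ℕ → Set) → Set
Eventually P = ∃ λ N → ∀ X → N ℕ.< X → P X

eventually-× : ∀ {P Q} → Eventually P → Eventually Q → Eventually (λ X → P X × Q X)
eventually-× (M , p) (N , q) = M ℕ.⊔ N , λ X M⊔N<X →
  p X (ℕₚ.≤-<-trans (ℕₚ.m≤m⊔n M N) M⊔N<X) , q X (ℕₚ.≤-<-trans (ℕₚ.m≤n⊔m M N) M⊔N<X)

eventually-∀ : ∀ n {P : Fin n → ℕ → Set} → (∀ i → Eventually (P i)) → Eventually (λ X → ∀ i → P i X)
eventually-∀ zero    _ = 0 , λ _ _ ()
eventually-∀ (suc n) p with eventually-× (p zero) (eventually-∀ n (p ∘ suc))
... | N , q = N , λ X N<X → λ { zero → proj₁ (q X N<X) ; (suc i) → proj₂ (q X N<X) i }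

eventually⇒ℤ : ∀ {P : ℤ → Set} → Eventually (P ∘ +_) → ∃ λ x₀ → ∀ x → x₀ < x → P x
eventually⇒ℤ (N , p) = + N , λ { (+ X) (+<+ N<X) → p X N<X }

∣i-n∣<n⇒0<i : ∀ i n → ∣ i - + n ∣ ℕ.< n → + 0 < i
∣i-n∣<n⇒0<i (+ zero)  n       lt =
  contradiction lt (ℕₚ.<-irrefl (trans (cong ∣_∣ (ℤₚ.+-identityˡ (- + n))) (ℤₚ.∣-i∣≡∣i∣ (+ n))))
∣i-n∣<n⇒0<i (+ suc m) n       _  = +<+ (s≤s z≤n)
∣i-n∣<n⇒0<i -[1+ m ]  (suc n) lt = contradiction lt (ℕₚ.<-asym (s≤s (s≤s (ℕₚ.m≤n+m n m))))

0<j-i⇒i<j : ∀ i j → + 0 < j - i → i < j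
0<j-i⇒i<j i j 0<j-i = subst₂ _<_ (ℤₚ.+-identityʳ i) (plus-minus i j) (ℤₚ.+-monoʳ-< i 0<j-i)
  where
  plus-minus : ∀ i j → i + (j - i) ≡ j
  plus-minus = solve-∀

eventually-pos : ∀ {Z : ℕ → ℤ} {d} → BigO (λ X → Z X - + (X ℕ.^ suc d)) d → Eventually (λ X → + 0 < Z X)
eventually-pos {Z} {d} (bigO C h) = C , λ { (suc X) (s≤s C≤X) → ∣i-n∣<n⇒0<i (Z (suc X)) _ (begin-strict
  ∣ Z (suc X) - + (suc X ℕ.^ suc d) ∣ ≤⟨ h X ⟩
  C ℕ.* suc X ℕ.^ d                   <⟨ ℕₚ.*-monoˡ-< (suc X ℕ.^ d) {{ℕₚ.m^n≢0 (suc X) d}} (s≤s C≤X) ⟩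
  suc X ℕ.^ suc d                     ∎) }
  where open ℕₚ.≤-Reasoning

eventually-< : ∀ {F G : ℕ → ℤ} {d} → BigO (λ X → G X - F X - + (X ℕ.^ suc d)) d → Eventually (λ X → F X < G X)
eventually-< {F} {G} leading with eventually-pos {λ X → G X - F X} leading
... | N , p = N , λ X N<X → 0<j-i⇒i<j (F X) (G X) (p X N<X)

adjCharMat·v₀-positive : ∀ k (A : Matrix (suc k)) → Eventually (λ X → + 0 < adjCharMat·v (suc k) A X zero)
adjCharMat·v₀-positive zero    A = 0 , λ _ _ → +<+ (s≤s z≤n)
adjCharMat·v₀-positive (suc k) A = eventually-pos (O-cong monic (adjCharMat·v-leading k A zero))
  where
  monic : ∀ X → adjCharMat·v (suc (suc k)) A X zero - + 1 * + (X ℕ.^ suc k)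
                ≡ adjCharMat·v (suc (suc k)) A X zero - + (X ℕ.^ suc k)
  monic X = cong (_-_ (adjCharMat·v (suc (suc k)) A X zero)) (ℤₚ.*-identityˡ (+ (X ℕ.^ suc k)))

adjCharMat·v-increasing : ∀ k (A : Matrix (suc k)) (i : Fin k) →
                          Eventually (λ X → adjCharMat·v (suc k) A X (inject₁ i) < adjCharMat·v (suc k) A X (suc i))
adjCharMat·v-increasing (suc k) A i =
  eventually-< (O-cong difference (O-- (adjCharMat·v-leading k A (suc i)) (adjCharMat·v-leading k A (inject₁ i))))
  where
  y = adjCharMat·v (suc (suc k)) A
  difference : ∀ X → (y X (suc i) - + suc (toℕ (suc i)) * + (X ℕ.^ suc k))
                     - (y X (inject₁ i) - + suc (toℕ (inject₁ i)) * + (X ℕ.^ suc k))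
                     ≡ y X (suc i) - y X (inject₁ i) - + (X ℕ.^ suc k)
  difference X = trans (cong (λ t → (y X (suc i) - + suc (toℕ (suc i)) * P) - (y X (inject₁ i) - + suc t * P))
                             (Finₚ.toℕ-inject₁ i))
                       (cancel (y X (suc i)) (y X (inject₁ i)) (+ suc (toℕ i)) P)
    where
    P = + (X ℕ.^ suc k)
    cancel : ∀ a b c p → (a - (+ 1 + c) * p) - (b - c * p) ≡ a - b - p
    cancel = solve-∀

adjCharMat·v-last<charPoly : ∀ k (A : Matrix (suc k)) →
                             Eventually (λ X → adjCharMat·v (suc k) A X (fromℕ k) < charPoly (suc k) A X)
adjCharMat·v-last<charPoly k A =
  eventually-< (O-cong swap (O-- (det-charMat-leading k A) (adjCharMat·v-O k A (fromℕ k))))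
  where
  swap : ∀ X → charPoly (suc k) A X - + (X ℕ.^ suc k) - adjCharMat·v (suc k) A X (fromℕ k)
               ≡ charPoly (suc k) A X - adjCharMat·v (suc k) A X (fromℕ k) - + (X ℕ.^ suc k)
  swap X = exchange (charPoly (suc k) A X) (+ (X ℕ.^ suc k)) (adjCharMat·v (suc k) A X (fromℕ k))
    where
    exchange : ∀ m p y → m - p - y ≡ m - y - p
    exchange = solve-∀

lemma2p10 : (k : ℕ) → (A : Matrix (suc k)) →
    ∃ λ (x₀ : ℤ) → (x : ℤ) → x₀ < x →
      let M = adj (suc k) (charMat (suc k) x A)
          y = λ (i : Fin (suc k)) → sumFin (suc k) (λ j → M i j * (+ suc (toℕ j)))
          m = det (suc k) (charMat (suc k) x A)
      in (+ 0 < y zero)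
         × ((i : Fin k) → y (inject₁ i) < y (suc i))
         × (y (fromℕ k) < m)
lemma2p10 k A = eventually⇒ℤ
  (eventually-× (adjCharMat·v₀-positive k A)
  (eventually-× (eventually-∀ k (adjCharMat·v-increasing k A))
                (adjCharMat·v-last<charPoly k A)))
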